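{- Let $\tau$ be a monad and $\varepsilon,\alpha,\beta,\gamma$ representable types, all in the sense described in the context. For all $m\in\mathrm{ErrorT}(\varepsilon,\tau)\cdot\alpha$, all continuous $h:\alpha\to\mathrm{ErrorT}(\varepsilon,\tau)\cdot\beta$ and all continuous $k:\beta\to\mathrm{ErrorT}(\varepsilon,\tau)\cdot\gamma$, $\mathrm{bindET}(\mathrm{bindET}\,m\,h)\,k=\mathrm{bindET}\,m\,(\lambda a.\,\mathrm{bindET}\,(h\,a)\,k)$.
   Context: All types are pointed cpos (pcpos) with least element $\bot$; $\alpha\to\beta$ is the pcpo of continuous functions. Fix a pcpo $\mathcal{U}$. A representable type is a pcpo $\alpha$ with continuous $\mathrm{emb}_\alpha:\alpha\to\mathcal{U}$ and $\mathrm{proj}_\alpha:\mathcal{U}\to\alpha$ such that $\mathrm{proj}_\alpha\circ\mathrm{emb}_\alpha=\mathrm{id}$ and $\mathrm{emb}_\alpha\circ\mathrm{proj}_\alpha\sqsubseteq\mathrm{id}$. $\mathcal{U}$ is representable with identities. If $\alpha,\beta$ are representable, then $\alpha\to\beta$ is representable with $\mathrm{emb}(h)=\mathrm{in}(\mathrm{emb}_\beta\circ h\circ\mathrm{proj}_\alpha)$ and $\mathrm{proj}(u)=\mathrm{proj}_\beta\circ\mathrm{out}(u)\circ\mathrm{emb}_\alpha$, for fixed continuous $\mathrm{in},\mathrm{out}$ with $\mathrm{out}\circ\mathrm{in}=\mathrm{id}$ and $\mathrm{in}\circ\mathrm{out}\sqsubseteq\mathrm{id}$. Define $\mathrm{coerce}_{\alpha,\beta}=\mathrm{proj}_\beta\circ\mathrm{emb}_\alpha$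 and $\mathrm{REP}(\alpha)=\mathrm{emb}_\alpha\circ\mathrm{proj}_\alpha$. $\mathcal{D}$ is the pcpo of deflations on $\mathcal{U}$ (continuous $d$ with $d\circ d=d\sqsubseteq\mathrm{id}$). A type constructor $\tau$ is a continuous $T_\tau:\mathcal{D}\to\mathcal{D}$. $\tau\cdot\alpha=\{u\in\mathcal{U}\mid T_\tau(\mathrm{REP}(\alpha))(u)=u\}$, with $\mathrm{emb}$ the inclusion and $\mathrm{proj}=T_\tau(\mathrm{REP}(\alpha))$. $\tau$ is a monad if it has continuous maps $\underline{\mathrm{fmap}}:(\mathcal{U}\to\mathcal{U})\to(\tau\cdot\mathcal{U}\to\tau\cdot\mathcal{U})$, $\underline{\mathrm{return}}:\mathcal{U}\to\tau\cdot\mathcal{U}$, $\underline{\mathrm{bind}}:\tau\cdot\mathcal{U}\to(\mathcal{U}\to\tau\cdot\mathcal{U})\to\tau\cdot\mathcal{U}$ satisfying: - $\mathrm{emb}_{\tau\cdot\mathcal{U}}\circ\underline{\mathrm{fmap}}(d)\circ\mathrm{proj}_{\tau\cdot\mathcal{U}}=T_\tau(d)$ for $d\in\mathcal{D}$; - $\underline{\mathrm{fmap}}(f\circ g)=\underline{\mathrm{fmap}}(f)\circ\underline{\mathrm{fmap}}(g)$; - $\underline{\mathrm{return}}(u)\mathbin{\underline{\mathrm{bind}}}k=k(u)$; - $(m\mathbin{\underline{\mathrm{bind}}}h)\mathbin{\underline{\mathrm{bind}}}k=m\mathbin{\underline{\mathrm{bind}}}(\lambda x.\,h(x)\mathbin{\underline{\mathrm{bind}}}k)$;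 - $\underline{\mathrm{fmap}}(f)(m)=m\mathbin{\underline{\mathrm{bind}}}(\underline{\mathrm{return}}\circ f)$. Polymorphic operations: - $\mathrm{return}_\alpha(a)=\mathrm{coerce}_{\tau\cdot\mathcal{U},\tau\cdot\alpha}(\underline{\mathrm{return}}(\mathrm{emb}_\alpha a))$; - for $m\in\tau\cdot\alpha$ and $k:\alpha\to\tau\cdot\beta$, $m\mathbin{>\!\!>\!\!=}k=\mathrm{coerce}_{\tau\cdot\mathcal{U},\tau\cdot\beta}\big(\mathrm{coerce}_{\tau\cdot\alpha,\tau\cdot\mathcal{U}}(m)\mathbin{\underline{\mathrm{bind}}}(\mathrm{coerce}_{\tau\cdot\beta,\tau\cdot\mathcal{U}}\circ k\circ\mathrm{proj}_\alpha)\big)$. Error types: for representable $\varepsilon,\alpha$, $\mathrm{Error}\,\varepsilon\cdot\alpha$ is a representable type isomorphic to $\varepsilon_\bot\oplus\alpha_\bot$ (strict sum of liftings). Its elements are $\bot$, $\mathrm{Err}(e)$ for $e\in\varepsilon$, and $\mathrm{Ok}(a)$ for $a\in\alpha$. The constructors are non-strict ($\mathrm{Err}(\bot)\neq\bot$), continuous and order-embedding, with disjoint images. $\mathrm{ErrorT}(\varepsilon,\tau)\cdot\alpha$ is a representable type with mutually inverse continuous bijections $\mathrm{ErrorT}:\tau\cdot(\mathrm{Error}\,\varepsilon\cdot\alpha)\to\mathrm{ErrorT}(\varepsilon,\tau)\cdot\alpha$ and $\mathrm{runET}$ in the other direction. For $m\in\mathrm{ErrorT}(\varepsilon,\tau)\cdot\alpha$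 and continuous $k:\alpha\to\mathrm{ErrorT}(\varepsilon,\tau)\cdot\beta$, define $\mathrm{bindET}\,m\,k=\mathrm{ErrorT}(\mathrm{runET}(m)\mathbin{>\!\!>\!\!=}R_k)$, where $R_k:\mathrm{Error}\,\varepsilon\cdot\alpha\to\tau\cdot(\mathrm{Error}\,\varepsilon\cdot\beta)$ is the strict case function: $R_k(\bot)=\bot$, $R_k(\mathrm{Err}\,e)=\mathrm{return}(\mathrm{Err}\,e)$, $R_k(\mathrm{Ok}\,a)=\mathrm{runET}(k\,a)$. -}

module Defs where

open import Data.Nat using (ℕ; suc)
open import Data.Product using (Σ; _×_; _,_; proj₁; proj₂)
open import Data.Sum using (_⊎_)
open import Relation.Nullary using (¬_)

record Chain {C : Set} (_⊑_ : C → C → Set) : Set where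
  constructor chain
  field
    seq : ℕ → C
    inc : ∀ n → seq n ⊑ seq (suc n)
open Chain public

IsLubIn : {C : Set} (_⊑_ : C → C → Set) → Chain _⊑_ → C → Set
IsLubIn _⊑_ c x = (∀ n → seq c n ⊑ x) × (∀ y → (∀ n → seq c n ⊑ y) → x ⊑ y)

-- The order is given as a preorder; equality of elements
-- is the induced equivalence x ≈ y = x ⊑ y × y ⊑ x (so the pcpo proper
-- is the quotient, a partial order).

record CPO : Set₁ where
  field
    Car     : Set
    _⊑_     : Car → Car → Set
    ⊑-refl  : ∀ {x} → x ⊑ x
    ⊑-trans : ∀ {x y z} → x ⊑ y → y ⊑ z → x ⊑ z
    ⊥       : Car
    ⊥-least : ∀ x → ⊥ ⊑ x
    lub     : (c : Chain _⊑_) → Σ Car (IsLubIn _⊑_ c)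

  _≈_ : Car → Car → Set
  x ≈ y = (x ⊑ y) × (y ⊑ x)

open CPO public using (Car)

infix 4 _∋_⊑_ _∋_≈_
_∋_⊑_ : (A : CPO) → Car A → Car A → Set
A ∋ x ⊑ y = CPO._⊑_ A x y

_∋_≈_ : (A : CPO) → Car A → Car A → Set
A ∋ x ≈ y = CPO._≈_ A x y

ChainOf : CPO → Set
ChainOf A = Chain (CPO._⊑_ A)

IsLub : (A : CPO) → ChainOf A → Car A → Set
IsLub A = IsLubIn (CPO._⊑_ A)

mapChain : {A B : CPO} (f : Car A → Car B) →
           (∀ {x y} → A ∋ x ⊑ y → B ∋ f x ⊑ f y) → ChainOf A → ChainOf B
mapChain f mono c = chain (λ n → f (seq c n)) (λ n → mono (inc c n))

record Cont (A B : CPO) : Set where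
  field
    fun  : Car A → Car B
    mono : ∀ {x y} → A ∋ x ⊑ y → B ∋ fun x ⊑ fun y
    cont : ∀ (c : ChainOf A) x → IsLub A c x → IsLub B (mapChain {A} {B} fun mono c) (fun x)
open Cont public

infixl 9 _$$_
_$$_ : {A B : CPO} → Cont A B → Car A → Car B
f $$ x = fun f x

idC : {A : CPO} → Cont A A
idC = record { fun = λ x → x ; mono = λ p → p ; cont = λ c x l → l }

infixr 9 _∘C_
_∘C_ : {A B C : CPO} → Cont B C → Cont A B → Cont A C
_∘C_ {A} {B} {C} g f = record
  { fun  = λ x → g $$ (f $$ x)
  ; mono = λ p → mono g (mono f p)
  ; cont = λ c x l → cont g (mapChain {A} {B} (fun f) (mono f) c) (f $$ x) (cont f c x l)
  }

module _ (A B : CPO) where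
  private
    module B = CPO B

  ⇒-chainAt : (fs : Chain {Cont A B} (λ f g → ∀ x → B ∋ f $$ x ⊑ g $$ x)) →
              Car A → ChainOf B
  ⇒-chainAt fs x = chain (λ n → seq fs n $$ x) (λ n → inc fs n x)

  infixr 0 _⇒_
  _⇒_ : CPO
  _⇒_ = record
    { Car     = Cont A B
    ; _⊑_     = λ f g → ∀ x → B ∋ f $$ x ⊑ g $$ x
    ; ⊑-refl  = λ x → B.⊑-refl
    ; ⊑-trans = λ p q x → B.⊑-trans (p x) (q x)
    ; ⊥       = record { fun = λ _ → B.⊥ ; mono = λ _ → B.⊑-refl
                       ; cont = λ c x l → (λ n → B.⊑-refl) , (λ y _ → B.⊥-least y) }
    ; ⊥-least = λ f x → B.⊥-least (f $$ x)
    ; lub     = λ fs →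
        let g : Car A → Car B
            g x = proj₁ (B.lub (⇒-chainAt fs x))
            gmono : ∀ {x y} → A ∋ x ⊑ y → B ∋ g x ⊑ g y
            gmono {x} {y} p = proj₂ (proj₂ (B.lub (⇒-chainAt fs x))) (g y)
                 (λ n → B.⊑-trans (mono (seq fs n) p) (proj₁ (proj₂ (B.lub (⇒-chainAt fs y))) n))
        in record
          { fun  = g
          ; mono = gmono
          ; cont = λ c x l →
              (λ n → gmono (proj₁ l n)) ,
              (λ y ub → proj₂ (proj₂ (B.lub (⇒-chainAt fs x))) y (λ i →
                 proj₂ (cont (seq fs i) c x l) y (λ n →
                   B.⊑-trans (proj₁ (proj₂ (B.lub (⇒-chainAt fs (seq c n)))) i) (ub n))))
          }
        , (λ n x → proj₁ (proj₂ (B.lub (⇒-chainAt fs x))) n)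
        , (λ h ub x → proj₂ (proj₂ (B.lub (⇒-chainAt fs x))) (h $$ x) (λ n → ub n x))
    }

pointwise : {A B : CPO} (fs : ChainOf (A ⇒ B)) (f : Cont A B) →
            IsLub (A ⇒ B) fs f → ∀ x → IsLub B (⇒-chainAt A B fs x) (f $$ x)
pointwise {A} {B} fs f (ub , least) x =
  (λ n → ub n x) ,
  (λ y ubs → CPO.⊑-trans B (least g (proj₁ (proj₂ (CPO.lub (A ⇒ B) fs))) x)
                            (proj₂ (CPO.lub B (⇒-chainAt A B fs x)) .proj₂ y ubs))
  where g = proj₁ (CPO.lub (A ⇒ B) fs)

appC : {A B C : CPO} → Cont A (B ⇒ C) → Car B → Cont A C
appC {A} {B} {C} F b = record
  { fun  = λ x → F $$ x $$ b
  ; mono = λ p → mono F p b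
  ; cont = λ c x l → pointwise (mapChain {A} {B ⇒ C} (fun F) (mono F) c) (F $$ x) (cont F c x l) b
  }

module _ (A : CPO) (P : Car A → Set) (P⊥ : P (CPO.⊥ A))
         (Pclosed : ∀ (c : ChainOf A) x → IsLub A c x → (∀ n → P (seq c n)) → P x) where
  private module A = CPO A

  Sub : CPO
  Sub = record
    { Car     = Σ A.Car P
    ; _⊑_     = λ x y → A ∋ proj₁ x ⊑ proj₁ y
    ; ⊑-refl  = A.⊑-refl
    ; ⊑-trans = A.⊑-trans
    ; ⊥       = A.⊥ , P⊥
    ; ⊥-least = λ x → A.⊥-least (proj₁ x)
    ; lub     = λ c →
        let c′ = chain (λ n → proj₁ (seq c n)) (inc c)
            l  = A.lub c′
        in (proj₁ l , Pclosed c′ (proj₁ l) (proj₂ l) (λ n → proj₂ (seq c n)))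
           , proj₁ (proj₂ l) , (λ y ub → proj₂ (proj₂ l) (proj₁ y) ub)
    }

  incl : Cont Sub A
  incl = record
    { fun  = proj₁
    ; mono = λ p → p
    ; cont = λ c x l →
        let c′ = chain (λ n → proj₁ (seq c n)) (inc c)
            m  = A.lub c′
            x′ = proj₁ m , Pclosed c′ (proj₁ m) (proj₂ m) (λ n → proj₂ (seq c n))
        in proj₁ l , (λ y ub → A.⊑-trans (proj₂ l x′ (proj₁ (proj₂ m))) (proj₂ (proj₂ m) y ub))
    }

IsDeflation : (A : CPO) → Cont A A → Set
IsDeflation A d = (∀ x → A ∋ d $$ (d $$ x) ≈ d $$ x) × (∀ x → A ∋ d $$ x ⊑ x)

private
  defl-⊥ : (A : CPO) → IsDeflation A (CPO.⊥ (A ⇒ A))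
  defl-⊥ A = (λ x → CPO.⊑-refl A , CPO.⊑-refl A) , (λ x → CPO.⊥-least A x)

  defl-closed : (A : CPO) (c : ChainOf (A ⇒ A)) (d : Cont A A) → IsLub (A ⇒ A) c d →
                (∀ n → IsDeflation A (seq c n)) → IsDeflation A d
  defl-closed A c d l ds =
      (λ x → ( proj₂ (pw (d $$ x)) (d $$ x) (λ n →
                 proj₂ (cont (seq c n) (⇒-chainAt A A c x) (d $$ x) (pw x)) (d $$ x) (λ m →
                   A.⊑-trans (proj₂ (ds n) (seq c m $$ x)) (proj₁ (pw x) m)))
             , proj₂ (pw x) (d $$ (d $$ x)) (λ n →
                 A.⊑-trans (proj₂ (proj₁ (ds n) x))
                   (A.⊑-trans (mono (seq c n) (proj₁ (pw x) n)) (proj₁ (pw (d $$ x)) n)))))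
    , (λ x → proj₂ (pw x) x (λ n → proj₂ (ds n) x))
    where
      module A = CPO A
      pw = pointwise c d l

Defl : CPO → CPO
Defl U = Sub (U ⇒ U) (IsDeflation U) (defl-⊥ U) (defl-closed U)

module _ (U : CPO) (dd : Car (Defl U)) where
  private
    d = proj₁ dd
    FixP : Car U → Set
    FixP x = U ∋ d $$ x ≈ x
    FixP⊥ : FixP (CPO.⊥ U)
    FixP⊥ = proj₂ (proj₂ dd) (CPO.⊥ U) , CPO.⊥-least U _
    FixPc : ∀ (c : ChainOf U) x → IsLub U c x → (∀ n → FixP (seq c n)) → FixP x
    FixPc c x l ps = proj₂ (proj₂ dd) x ,
      proj₂ l (d $$ x) (λ n → CPO.⊑-trans U (proj₂ (ps n)) (mono d (proj₁ l n)))

  Fix : CPO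
  Fix = Sub U FixP FixP⊥ FixPc

  Fix-incl : Cont Fix U
  Fix-incl = incl U FixP FixP⊥ FixPc

record Rep (U : CPO) : Set₁ where
  field
    Ty      : CPO
    emb     : Cont Ty U
    proj    : Cont U Ty
    retract : ∀ x → Ty ∋ proj $$ (emb $$ x) ≈ x
    emb-proj⊑ : ∀ u → U ∋ emb $$ (proj $$ u) ⊑ u
open Rep public

URep : (U : CPO) → Rep U
URep U = record { Ty = U ; emb = idC ; proj = idC
                ; retract = λ x → CPO.⊑-refl U , CPO.⊑-refl U
                ; emb-proj⊑ = λ u → CPO.⊑-refl U }

coerce : {U : CPO} (α β : Rep U) → Cont (Ty α) (Ty β)
coerce α β = proj β ∘C emb α

REP : {U : CPO} → Rep U → Car (Defl U)
REP {U} α = emb α ∘C proj α ,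
  (λ u → mono (emb α) (proj₁ (retract α (proj α $$ u))) ,
         mono (emb α) (proj₂ (retract α (proj α $$ u)))) ,
  emb-proj⊑ α

TyCon : CPO → Set
TyCon U = Cont (Defl U) (Defl U)

infixr 20 _·_
_·_ : {U : CPO} → TyCon U → Rep U → Rep U
_·_ {U} T α = record
  { Ty   = Fix U d
  ; emb  = Fix-incl U d
  ; proj = record
      { fun  = λ u → (td $$ u) , proj₁ (proj₂ d) u
      ; mono = λ p → mono td p
      ; cont = λ c u l → proj₁ (cont td c u l) , (λ y ub → proj₂ (cont td c u l) (proj₁ y) ub)
      }
  ; retract   = λ x → proj₁ (proj₂ x) , proj₂ (proj₂ x)
  ; emb-proj⊑ = λ u → proj₂ (proj₂ d) u
  }
  where
    d  = T $$ REP α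
    td = proj₁ d

record Monad (U : CPO) (T : TyCon U) : Set where
  private
    τU = T · URep U
    TU = Ty τU
  field
    fmap : Cont (U ⇒ U) (TU ⇒ TU)
    ret  : Cont U TU
    bind : Cont TU ((U ⇒ TU) ⇒ TU)
    fmap-T     : ∀ (d : Car (Defl U)) u →
                 U ∋ emb τU $$ (fmap $$ proj₁ d $$ (proj τU $$ u)) ≈ proj₁ (T $$ d) $$ u
    fmap-∘     : ∀ f g m → TU ∋ fmap $$ (f ∘C g) $$ m ≈ fmap $$ f $$ (fmap $$ g $$ m)
    bind-ret   : ∀ u k → TU ∋ bind $$ (ret $$ u) $$ k ≈ k $$ u
    bind-assoc : ∀ m h k → TU ∋ bind $$ (bind $$ m $$ h) $$ k ≈ bind $$ m $$ (appC bind k ∘C h)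
    fmap-bind  : ∀ f m → TU ∋ fmap $$ f $$ m ≈ bind $$ m $$ (ret ∘C f)

module Poly {U : CPO} {T : TyCon U} (M : Monad U T) where
  open Monad M
  private τU = T · URep U

  returnC : (α : Rep U) → Cont (Ty α) (Ty (T · α))
  returnC α = coerce τU (T · α) ∘C ret ∘C emb α

  bindC : (α β : Rep U) → Cont (Ty α) (Ty (T · β)) → Cont (Ty (T · α)) (Ty (T · β))
  bindC α β k = coerce τU (T · β) ∘C appC bind (coerce (T · β) τU ∘C k ∘C proj α)
                ∘C coerce (T · α) τU

-- Error types:  Error ε · α ≅ ε⊥ ⊕ α⊥

record ErrorType {U : CPO} (ε α : Rep U) : Set₁ where
  field
    E     : Rep U
    Err   : Cont (Ty ε) (Ty E)
    Ok    : Cont (Ty α) (Ty E)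
    Err-reflect : ∀ {x y} → Ty E ∋ Err $$ x ⊑ Err $$ y → Ty ε ∋ x ⊑ y
    Ok-reflect  : ∀ {x y} → Ty E ∋ Ok $$ x ⊑ Ok $$ y → Ty α ∋ x ⊑ y
    Err≉⊥  : ∀ e → ¬ (Ty E ∋ Err $$ e ≈ CPO.⊥ (Ty E))
    Ok≉⊥   : ∀ a → ¬ (Ty E ∋ Ok $$ a ≈ CPO.⊥ (Ty E))
    Err≉Ok : ∀ e a → ¬ (Ty E ∋ Err $$ e ≈ Ok $$ a)
    cases  : ∀ x → (Ty E ∋ x ≈ CPO.⊥ (Ty E))
                   ⊎ (Σ (Car (Ty ε)) λ e → Ty E ∋ x ≈ Err $$ e)
                   ⊎ (Σ (Car (Ty α)) λ a → Ty E ∋ x ≈ Ok $$ a)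
    scase     : (X : CPO) → Cont (Ty ε) X → Cont (Ty α) X → Cont (Ty E) X
    scase-⊥   : ∀ X f g → X ∋ scase X f g $$ CPO.⊥ (Ty E) ≈ CPO.⊥ X
    scase-Err : ∀ X f g e → X ∋ scase X f g $$ (Err $$ e) ≈ f $$ e
    scase-Ok  : ∀ X f g a → X ∋ scase X f g $$ (Ok $$ a) ≈ g $$ a
open ErrorType public

record ErrorTType {U : CPO} (T : TyCon U) {ε α : Rep U} (Eα : ErrorType ε α) : Set₁ where
  field
    ET      : Rep U
    toET    : Cont (Ty (T · E Eα)) (Ty ET)
    runET   : Cont (Ty ET) (Ty (T · E Eα))
    run-to  : ∀ x → Ty (T · E Eα) ∋ runET $$ (toET $$ x) ≈ x
    to-run  : ∀ y → Ty ET ∋ toET $$ (runET $$ y) ≈ y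
open ErrorTType public

module BindET {U : CPO} {T : TyCon U} (M : Monad U T) {ε : Rep U}
              (Er : (α : Rep U) → ErrorType ε α)
              (ErT : (α : Rep U) → ErrorTType T (Er α)) where
  open Poly M

  ETy : Rep U → CPO
  ETy α = Ty (ET (ErT α))

  Rk : (α β : Rep U) → Cont (Ty α) (ETy β) → Cont (Ty (E (Er α))) (Ty (T · E (Er β)))
  Rk α β k = scase (Er α) (Ty (T · E (Er β)))
                   (returnC (E (Er β)) ∘C Err (Er β))
                   (runET (ErT β) ∘C k)

  bindETC : (α β : Rep U) → Cont (Ty α) (ETy β) → Cont (ETy α) (ETy β)
  bindETC α β k = toET (ErT β) ∘C bindC (E (Er α)) (E (Er β)) (Rk α β k) ∘C runET (ErT α)

  bindET : (α β : Rep U) → Car (ETy α) → Cont (Ty α) (ETy β) → Car (ETy β)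
  bindET α β m k = bindETC α β k $$ m

-- The polymorphic bind  m >>= k  of a monad τ is defined by coercing
-- through the universal type τ·U and using the monomorphic bind there.  The key
-- observation is that the projection onto τ·β is the deflation
-- T(REP β), which is  fmap (REP β) = bind _ (return ∘ REP β); with
-- associativity of the monomorphic bind this lets the coercions be
-- absorbed, giving an "unfolding" of polymorphic bind into monomorphic
-- bind (bindC-unfold).

module Submission where

open import Defs
open import Data.Product using (_,_; proj₁; proj₂; uncurry)
open import Data.Sum using ([_,_]′)
open import Level using (0ℓ)
open import Relation.Binary.Bundles using (Preorder)
import Relation.Binary.Reasoning.Preorder as PreorderReasoning

-- A pcpo, viewed as a preorder whose underlying equality is the induced
-- equivalence ≈; this gives mixed ⊑/≈ reasoning chains.
preorder : CPO → Preorder 0ℓ 0ℓ 0ℓ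
preorder A = record
  { Carrier    = Car A
  ; _≈_        = CPO._≈_ A
  ; _≲_        = CPO._⊑_ A
  ; isPreorder = record
    { isEquivalence = record
      { refl  = ⊑-refl , ⊑-refl
      ; sym   = λ (p , q) → q , p
      ; trans = λ (p , q) (p′ , q′) → ⊑-trans p p′ , ⊑-trans q′ q
      }
    ; reflexive = proj₁
    ; trans     = ⊑-trans
    }
  }
  where open CPO A

module ⊑-Reasoning (A : CPO) = PreorderReasoning (preorder A)

-- Monotone maps (in particular continuous ones) respect ≈.  The order of
-- a sub-pcpo only looks at first components, so x and y often cannot be
-- inferred and are given explicitly below.
cont-cong : {A B : CPO} (f : Cont A B) {x y : Car A} → A ∋ x ≈ y → B ∋ f $$ x ≈ f $$ y
cont-cong f (p , q) = mono f p , mono f q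

below-⊥ : (A : CPO) {x y : Car A} →
          A ∋ x ⊑ CPO.⊥ A → A ∋ y ⊑ CPO.⊥ A → A ∋ x ≈ y
below-⊥ A p q = ⊑-trans p (⊥-least _) , ⊑-trans q (⊥-least _)
  where open CPO A

proj-strict : {U : CPO} (α : Rep U) → Ty α ∋ proj α $$ CPO.⊥ U ⊑ CPO.⊥ (Ty α)
proj-strict {U} α = begin
  proj α $$ CPO.⊥ U                       ≲⟨ mono (proj α) (CPO.⊥-least U _) ⟩
  proj α $$ (emb α $$ CPO.⊥ (Ty α))       ≈⟨ retract α _ ⟩
  CPO.⊥ (Ty α)                            ∎
  where open ⊑-Reasoning (Ty α)

module PolyLaws {U : CPO} {T : TyCon U} (M : Monad U T) where
  open Monad M
  open Poly M

  τU : Rep U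
  τU = T · URep U

  TU : CPO
  TU = Ty τU

  Δ : Rep U → Cont U U
  Δ α = proj₁ (T $$ REP α)

  liftK : (α β : Rep U) → Cont (Ty α) (Ty (T · β)) → Cont U TU
  liftK α β k = coerce (T · β) τU ∘C k ∘C proj α

  -- Since REP α ⊑ id and T is monotone, τ·α is contained in τ·U:
  -- coercing an element of τ·α into τ·U does not change it.
  widen : ∀ α (x : Car (Ty (T · α))) → U ∋ proj₁ (coerce (T · α) τU $$ x) ≈ proj₁ x
  widen α (x , x-fixed) = proj₂ (proj₂ (T $$ REP (URep U))) x
                        , ⊑-trans (proj₂ x-fixed)
                                  (mono T {REP α} {REP (URep U)} (emb-proj⊑ α) x)
    where open CPO U

  -- The deflation T(REP α) is fmap (REP α), i.e. binding with return ∘ REP α.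
  Δ-bind : ∀ α (n : Car TU) →
           U ∋ Δ α $$ proj₁ n ≈ proj₁ (bind $$ n $$ (ret ∘C proj₁ (REP α)))
  Δ-bind α n = begin-equality
    Δ α $$ proj₁ n                                     ≈⟨ fmap-T (REP α) (proj₁ n) ⟨
    proj₁ (fmap $$ proj₁ (REP α) $$ (proj τU $$ proj₁ n))
                                 ≈⟨ cont-cong (fmap $$ proj₁ (REP α)) {proj τU $$ proj₁ n} {n} (proj₂ n) ⟩
    proj₁ (fmap $$ proj₁ (REP α) $$ n)                 ≈⟨ fmap-bind (proj₁ (REP α)) n ⟩
    proj₁ (bind $$ n $$ (ret ∘C proj₁ (REP α)))        ∎
    where open ⊑-Reasoning U

  bind-congʳ : ∀ n {f g : Cont U TU} → (∀ u → TU ∋ f $$ u ≈ g $$ u) →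
               TU ∋ bind $$ n $$ f ≈ bind $$ n $$ g
  bind-congʳ n f≈g = mono (bind $$ n) (λ u → proj₁ (f≈g u))
                   , mono (bind $$ n) (λ u → proj₂ (f≈g u))

  bind-return-REP : ∀ β (y : Car (Ty (T · β))) →
                    TU ∋ bind $$ (coerce (T · β) τU $$ y) $$ (ret ∘C proj₁ (REP β))
                       ≈ coerce (T · β) τU $$ y
  bind-return-REP β y = begin-equality
    proj₁ (bind $$ y↑ $$ (ret ∘C proj₁ (REP β)))  ≈⟨ Δ-bind β y↑ ⟨
    Δ β $$ proj₁ y↑                               ≈⟨ cont-cong (Δ β) (widen β y) ⟩
    Δ β $$ proj₁ y                                ≈⟨ proj₂ y ⟩
    proj₁ y                                       ≈⟨ widen β y ⟨
    proj₁ y↑                                      ∎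
    where
      open ⊑-Reasoning U
      y↑ : Car TU
      y↑ = coerce (T · β) τU $$ y

  -- Polymorphic bind is monomorphic bind up to the coercions: the outer
  -- projection onto τ·β can be dropped since every result of the
  -- continuation already lies in τ·β.
  bindC-unfold : ∀ α β k (x : Car (Ty (T · α))) →
                 U ∋ proj₁ (bindC α β k $$ x)
                   ≈ proj₁ (bind $$ (coerce (T · α) τU $$ x) $$ liftK α β k)
  bindC-unfold α β k x = begin-equality
    Δ β $$ proj₁ (bind $$ x↑ $$ K)                        ≈⟨ Δ-bind β (bind $$ x↑ $$ K) ⟩
    proj₁ (bind $$ (bind $$ x↑ $$ K) $$ ret∘REP)          ≈⟨ bind-assoc x↑ K ret∘REP ⟩
    proj₁ (bind $$ x↑ $$ (appC bind ret∘REP ∘C K))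
                       ≈⟨ bind-congʳ x↑ (λ u → bind-return-REP β (k $$ (proj α $$ u))) ⟩
    proj₁ (bind $$ x↑ $$ K)                               ∎
    where
      open ⊑-Reasoning U
      x↑ : Car TU
      x↑ = coerce (T · α) τU $$ x
      K ret∘REP : Cont U TU
      K = liftK α β k
      ret∘REP = ret ∘C proj₁ (REP β)

  returnC-unfold : ∀ α (a : Car (Ty α)) →
                   U ∋ proj₁ (returnC α $$ a) ≈ proj₁ (ret $$ (emb α $$ a))
  returnC-unfold α a = begin-equality
    Δ α $$ proj₁ r                                  ≈⟨ Δ-bind α r ⟩
    proj₁ (bind $$ r $$ (ret ∘C proj₁ (REP α)))     ≈⟨ bind-ret (emb α $$ a) (ret ∘C proj₁ (REP α)) ⟩
    proj₁ (ret $$ (emb α $$ (proj α $$ r′)))        ≈⟨ cont-cong (ret ∘C emb α) (retract α a) ⟩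
    proj₁ r                                         ∎
    where
      open ⊑-Reasoning U
      r′ : Car U
      r′ = emb α $$ a
      r : Car TU
      r = ret $$ r′

  bindC-return : ∀ α β k (a : Car (Ty α)) →
                 Ty (T · β) ∋ bindC α β k $$ (returnC α $$ a) ≈ k $$ a
  bindC-return α β k a = begin-equality
    proj₁ (bindC α β k $$ (returnC α $$ a))          ≈⟨ bindC-unfold α β k (returnC α $$ a) ⟩
    proj₁ (bind $$ (coerce (T · α) τU $$ (returnC α $$ a)) $$ K)
              ≈⟨ cont-cong (appC bind K) {coerce (T · α) τU $$ (returnC α $$ a)} {ret $$ (emb α $$ a)}
                   returned ⟩
    proj₁ (bind $$ (ret $$ (emb α $$ a)) $$ K)       ≈⟨ bind-ret (emb α $$ a) K ⟩
    proj₁ (K $$ (emb α $$ a))                        ≈⟨ widen β (k $$ (proj α $$ (emb α $$ a))) ⟩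
    proj₁ (k $$ (proj α $$ (emb α $$ a)))            ≈⟨ cont-cong k (retract α a) ⟩
    proj₁ (k $$ a)                                   ∎
    where
      open ⊑-Reasoning U
      K : Cont U TU
      K = liftK α β k
      returned : U ∋ proj₁ (coerce (T · α) τU $$ (returnC α $$ a)) ≈ proj₁ (ret $$ (emb α $$ a))
      returned = begin-equality
        proj₁ (coerce (T · α) τU $$ (returnC α $$ a))  ≈⟨ widen α (returnC α $$ a) ⟩
        proj₁ (returnC α $$ a)                         ≈⟨ returnC-unfold α a ⟩
        proj₁ (ret $$ (emb α $$ a))                    ∎

  bindC-strict : ∀ α β k → Ty (T · β) ∋ k $$ CPO.⊥ (Ty α) ⊑ CPO.⊥ (Ty (T · β)) →
                 Ty (T · β) ∋ bindC α β k $$ CPO.⊥ (Ty (T · α)) ⊑ CPO.⊥ (Ty (T · β))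
  bindC-strict α β k k-strict = begin
    proj₁ (bindC α β k $$ CPO.⊥ (Ty (T · α)))     ≈⟨ bindC-unfold α β k (CPO.⊥ (Ty (T · α))) ⟩
    proj₁ (bind $$ ⊥↑ $$ K)                       ≲⟨ mono bind {⊥↑} {ret $$ CPO.⊥ U} ⊥↑⊑ret K ⟩
    proj₁ (bind $$ (ret $$ CPO.⊥ U) $$ K)         ≈⟨ bind-ret (CPO.⊥ U) K ⟩
    proj₁ (K $$ CPO.⊥ U)                          ≈⟨ widen β (k $$ (proj α $$ CPO.⊥ U)) ⟩
    proj₁ (k $$ (proj α $$ CPO.⊥ U))              ≲⟨ mono k (proj-strict α) ⟩
    proj₁ (k $$ CPO.⊥ (Ty α))                     ≲⟨ k-strict ⟩
    CPO.⊥ U                                       ∎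
    where
      open ⊑-Reasoning U
      K : Cont U TU
      K = liftK α β k
      ⊥↑ : Car TU
      ⊥↑ = coerce (T · α) τU $$ CPO.⊥ (Ty (T · α))
      ⊥↑⊑ret : TU ∋ ⊥↑ ⊑ ret $$ CPO.⊥ U
      ⊥↑⊑ret = CPO.⊑-trans U (proj₁ (widen α (CPO.⊥ (Ty (T · α))))) (CPO.⊥-least U _)

  bindC-congʳ : ∀ α β {k k′} → (∀ a → Ty (T · β) ∋ k $$ a ≈ k′ $$ a) →
                ∀ x → Ty (T · β) ∋ bindC α β k $$ x ≈ bindC α β k′ $$ x
  bindC-congʳ α β {k} {k′} k≈k′ x =
    cont-cong (coerce τU (T · β)) {bind $$ x↑ $$ liftK α β k} {bind $$ x↑ $$ liftK α β k′}
      (bind-congʳ x↑ λ u → cont-cong (coerce (T · β) τU) {k $$ (proj α $$ u)} {k′ $$ (proj α $$ u)}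
                                      (k≈k′ (proj α $$ u)))
    where
      x↑ : Car TU
      x↑ = coerce (T · α) τU $$ x

  bindC-assoc : ∀ α β γ h k (x : Car (Ty (T · α))) →
                Ty (T · γ) ∋ bindC β γ k $$ (bindC α β h $$ x) ≈ bindC α γ (bindC β γ k ∘C h) $$ x
  bindC-assoc α β γ h k x = begin-equality
    proj₁ (bindC β γ k $$ (bindC α β h $$ x))             ≈⟨ bindC-unfold β γ k (bindC α β h $$ x) ⟩
    proj₁ (bind $$ (coerce (T · β) τU $$ (bindC α β h $$ x)) $$ Kk)
               ≈⟨ cont-cong (appC bind Kk) {coerce (T · β) τU $$ (bindC α β h $$ x)} {bind $$ x↑ $$ Kh} inner ⟩
    proj₁ (bind $$ (bind $$ x↑ $$ Kh) $$ Kk)              ≈⟨ bind-assoc x↑ Kh Kk ⟩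
    proj₁ (bind $$ x↑ $$ (appC bind Kk ∘C Kh))            ≈⟨ bind-congʳ x↑ composite ⟩
    proj₁ (bind $$ x↑ $$ liftK α γ (bindC β γ k ∘C h))    ≈⟨ bindC-unfold α γ (bindC β γ k ∘C h) x ⟨
    proj₁ (bindC α γ (bindC β γ k ∘C h) $$ x)             ∎
    where
      open ⊑-Reasoning U
      x↑ : Car TU
      x↑ = coerce (T · α) τU $$ x
      Kh Kk : Cont U TU
      Kh = liftK α β h
      Kk = liftK β γ k

      inner : U ∋ proj₁ (coerce (T · β) τU $$ (bindC α β h $$ x)) ≈ proj₁ (bind $$ x↑ $$ Kh)
      inner = begin-equality
        proj₁ (coerce (T · β) τU $$ (bindC α β h $$ x))  ≈⟨ widen β (bindC α β h $$ x) ⟩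
        proj₁ (bindC α β h $$ x)                         ≈⟨ bindC-unfold α β h x ⟩
        proj₁ (bind $$ x↑ $$ Kh)                         ∎

      composite : ∀ u → TU ∋ bind $$ (Kh $$ u) $$ Kk ≈ liftK α γ (bindC β γ k ∘C h) $$ u
      composite u = begin-equality
        proj₁ (bind $$ (Kh $$ u) $$ Kk)            ≈⟨ bindC-unfold β γ k (h $$ (proj α $$ u)) ⟨
        proj₁ (bindC β γ k $$ (h $$ (proj α $$ u))) ≈⟨ widen γ (bindC β γ k $$ (h $$ (proj α $$ u))) ⟨
        proj₁ (liftK α γ (bindC β γ k ∘C h) $$ u)  ∎

module ErrorTLaws {U : CPO} {T : TyCon U} (M : Monad U T) {ε : Rep U}
                  (Er : (α : Rep U) → ErrorType ε α)
                  (ErT : (α : Rep U) → ErrorTType T (Er α)) where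
  open Poly M
  open PolyLaws M
  open BindET M Er ErT

  TE : Rep U → CPO
  TE α = Ty (T · E (Er α))

  Rk-⊥ : ∀ α β k → TE β ∋ Rk α β k $$ CPO.⊥ (Ty (E (Er α))) ≈ CPO.⊥ (TE β)
  Rk-⊥ α β k = scase-⊥ (Er α) (TE β) (returnC (E (Er β)) ∘C Err (Er β)) (runET (ErT β) ∘C k)

  Rk-Err : ∀ α β k e → TE β ∋ Rk α β k $$ (Err (Er α) $$ e) ≈ returnC (E (Er β)) $$ (Err (Er β) $$ e)
  Rk-Err α β k = scase-Err (Er α) (TE β) (returnC (E (Er β)) ∘C Err (Er β)) (runET (ErT β) ∘C k)

  Rk-Ok : ∀ α β k a → TE β ∋ Rk α β k $$ (Ok (Er α) $$ a) ≈ runET (ErT β) $$ (k $$ a)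
  Rk-Ok α β k = scase-Ok (Er α) (TE β) (returnC (E (Er β)) ∘C Err (Er β)) (runET (ErT β) ∘C k)

  module _ (α β γ : Rep U) (h : Cont (Ty α) (ETy β)) (k : Cont (Ty β) (ETy γ)) where

    bindRk : Cont (TE β) (TE γ)
    bindRk = bindC (E (Er β)) (E (Er γ)) (Rk β γ k)

    Rk∘ : Cont (Ty (E (Er α))) (TE γ)
    Rk∘ = Rk α γ (bindETC β γ k ∘C h)

    Rk-bindET-⊥ : ∀ x → Ty (E (Er α)) ∋ x ≈ CPO.⊥ (Ty (E (Er α))) →
                  TE γ ∋ bindRk $$ (Rk α β h $$ x) ≈ Rk∘ $$ x
    Rk-bindET-⊥ x x≈⊥ = below-⊥ (TE γ) {bindRk $$ (Rk α β h $$ x)} {Rk∘ $$ x}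
      (begin
        bindRk $$ (Rk α β h $$ x)              ≲⟨ mono (bindRk ∘C Rk α β h) (proj₁ x≈⊥) ⟩
        bindRk $$ (Rk α β h $$ ⊥Eα)            ≲⟨ mono bindRk {Rk α β h $$ ⊥Eα} {CPO.⊥ (TE β)}
                                                        (proj₁ (Rk-⊥ α β h)) ⟩
        bindRk $$ CPO.⊥ (TE β)                 ≲⟨ bindC-strict (E (Er β)) (E (Er γ)) (Rk β γ k)
                                                                (proj₁ (Rk-⊥ β γ k)) ⟩
        CPO.⊥ (TE γ)                           ∎)
      (begin
        Rk∘ $$ x                               ≲⟨ mono Rk∘ (proj₁ x≈⊥) ⟩
        Rk∘ $$ ⊥Eα                             ≲⟨ proj₁ (Rk-⊥ α γ (bindETC β γ k ∘C h)) ⟩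
        CPO.⊥ (TE γ)                           ∎)
      where
        open ⊑-Reasoning (TE γ)
        ⊥Eα : Car (Ty (E (Er α)))
        ⊥Eα = CPO.⊥ (Ty (E (Er α)))

    Rk-bindET-Err : ∀ x e → Ty (E (Er α)) ∋ x ≈ Err (Er α) $$ e →
                    TE γ ∋ bindRk $$ (Rk α β h $$ x) ≈ Rk∘ $$ x
    Rk-bindET-Err x e x≈Err = begin-equality
      bindRk $$ (Rk α β h $$ x)              ≈⟨ cont-cong (bindRk ∘C Rk α β h) {x} {Err (Er α) $$ e} x≈Err ⟩
      bindRk $$ (Rk α β h $$ (Err (Er α) $$ e))
                 ≈⟨ cont-cong bindRk {Rk α β h $$ (Err (Er α) $$ e)} {returnC (E (Er β)) $$ Err′}
                                     (Rk-Err α β h e) ⟩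
      bindRk $$ (returnC (E (Er β)) $$ Err′) ≈⟨ bindC-return (E (Er β)) (E (Er γ)) (Rk β γ k) Err′ ⟩
      Rk β γ k $$ Err′                       ≈⟨ Rk-Err β γ k e ⟩
      returnC (E (Er γ)) $$ (Err (Er γ) $$ e) ≈⟨ Rk-Err α γ (bindETC β γ k ∘C h) e ⟨
      Rk∘ $$ (Err (Er α) $$ e)               ≈⟨ cont-cong Rk∘ x≈Err ⟨
      Rk∘ $$ x                               ∎
      where
        open ⊑-Reasoning (TE γ)
        Err′ : Car (Ty (E (Er β)))
        Err′ = Err (Er β) $$ e

    Rk-bindET-Ok : ∀ x a → Ty (E (Er α)) ∋ x ≈ Ok (Er α) $$ a →
                   TE γ ∋ bindRk $$ (Rk α β h $$ x) ≈ Rk∘ $$ x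
    Rk-bindET-Ok x a x≈Ok = begin-equality
      bindRk $$ (Rk α β h $$ x)              ≈⟨ cont-cong (bindRk ∘C Rk α β h) {x} {Ok (Er α) $$ a} x≈Ok ⟩
      bindRk $$ (Rk α β h $$ (Ok (Er α) $$ a))
                 ≈⟨ cont-cong bindRk {Rk α β h $$ (Ok (Er α) $$ a)} {runET (ErT β) $$ (h $$ a)}
                                     (Rk-Ok α β h a) ⟩
      bindRk $$ (runET (ErT β) $$ (h $$ a))  ≈⟨ run-to (ErT γ) (bindRk $$ (runET (ErT β) $$ (h $$ a))) ⟨
      runET (ErT γ) $$ (bindETC β γ k $$ (h $$ a)) ≈⟨ Rk-Ok α γ (bindETC β γ k ∘C h) a ⟨
      Rk∘ $$ (Ok (Er α) $$ a)                ≈⟨ cont-cong Rk∘ x≈Ok ⟨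
      Rk∘ $$ x                               ∎
      where open ⊑-Reasoning (TE γ)

    Rk-bindET : ∀ x → TE γ ∋ bindRk $$ (Rk α β h $$ x) ≈ Rk∘ $$ x
    Rk-bindET x = [ Rk-bindET-⊥ x , [ uncurry (Rk-bindET-Err x) , uncurry (Rk-bindET-Ok x) ]′ ]′
                    (cases (Er α) x)

-- Associativity of bindET: unfold both sides to polymorphic binds on
-- τ·(Error ε·α), cancel runET ∘ ErrorT, reassociate, and identify the
-- continuations by Rk-bindET.
theorem5 : (U : CPO) (T : TyCon U) (M : Monad U T) (ε : Rep U)
           (Er : (α : Rep U) → ErrorType ε α)
           (ErT : (α : Rep U) → ErrorTType T (Er α))
           (α β γ : Rep U)
           (m : Car (Ty (ET (ErT α))))
           (h : Cont (Ty α) (Ty (ET (ErT β))))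
           (k : Cont (Ty β) (Ty (ET (ErT γ)))) →
           Ty (ET (ErT γ)) ∋ BindET.bindET M Er ErT β γ (BindET.bindET M Er ErT α β m h) k
                            ≈ BindET.bindET M Er ErT α γ m (BindET.bindETC M Er ErT β γ k ∘C h)
theorem5 U T M ε Er ErT α β γ m h k =
  cont-cong (toET (ErT γ)) {bind-k $$ (runET (ErT β) $$ (toET (ErT β) $$ (bind-h $$ m₀)))}
                           {bind-kh $$ m₀} (begin-equality
    bind-k $$ (runET (ErT β) $$ (toET (ErT β) $$ (bind-h $$ m₀)))
                  ≈⟨ cont-cong bind-k {runET (ErT β) $$ (toET (ErT β) $$ (bind-h $$ m₀))} {bind-h $$ m₀}
                                (run-to (ErT β) (bind-h $$ m₀)) ⟩
    bind-k $$ (bind-h $$ m₀)                  ≈⟨ bindC-assoc Eα Eβ Eγ (Rk α β h) (Rk β γ k) m₀ ⟩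
    bindC Eα Eγ (bind-k ∘C Rk α β h) $$ m₀
                  ≈⟨ bindC-congʳ Eα Eγ {bind-k ∘C Rk α β h} {Rk α γ (bindETC β γ k ∘C h)}
                                 (Rk-bindET α β γ h k) m₀ ⟩
    bind-kh $$ m₀                             ∎)
  where
    open Poly M
    open PolyLaws M
    open BindET M Er ErT
    open ErrorTLaws M Er ErT
    open ⊑-Reasoning (TE γ)
    Eα Eβ Eγ : Rep U
    Eα = E (Er α)
    Eβ = E (Er β)
    Eγ = E (Er γ)
    m₀ : Car (TE α)
    m₀ = runET (ErT α) $$ m
    bind-h : Cont (TE α) (TE β)
    bind-h = bindC Eα Eβ (Rk α β h)
    bind-k : Cont (TE β) (TE γ)
    bind-k = bindC Eβ Eγ (Rk β γ k)
    bind-kh : Cont (TE α) (TE γ)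
    bind-kh = bindC Eα Eγ (Rk α γ (bindETC β γ k ∘C h))
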